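{- Let $\alpha,\beta$ be parameters and $x$ a variable, and set $x'=\frac{x}{1+(\alpha-\beta)x}$. For all finitely supported sequences $v=(v_j)_{j\ge1}$ and $u=(u_j)_{j\ge1}$ of nonnegative integers, the partition function of the following two-row lattice equals $\delta_{u,v}$ (i.e. $T(-x)\widetilde T(x')=1$): the bottom row has horizontal labels in $\{0,1\}$, bottom labels $v$, right boundary value $0$, free left boundary, and weights $W(a,b;c,d)=1$ if $a=b=c=d=0$, $=\frac{ -x}{1+\alpha x}$ if $a=1$, $=\frac{1-\beta x}{1+\alpha x}$ if $a=0$ and $(b,c,d)\neq(0,0,0)$; the top row has nonnegative integer horizontal labels, top labels $u$, right boundary value $0$, free left boundary, and weights $\widetilde W(a,b;c,d)=\big(\frac{x'}{1-\alpha x'}\big)^a$ if $b=c$, $=\big(\frac{x'}{1-\alpha x'}\big)^a\frac{1+\beta x'}{1-\alpha x'}$ if $b>c$, $=0$ if $b<c$.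
   Context: A vertex has left label $a$, bottom label $b$, right label $c$, top label $d$, and its weight is $0$ unless $a+b=c+d$. A row is a sequence of vertices at sites $j=1,2,\dots$, the right label at site $j$ being the left label at site $j+1$; vertical labels are nonnegative integers; the left label at site $1$ is free (summed over) and the right labels must be eventually equal to the prescribed value. In the two-row lattice, the top labels of the bottom row are the bottom labels of the top row and are summed over; the partition function is the sum over all labelings of non-prescribed edges of the product of vertex weights. The bottom row is the row transfer matrix of the row model for $G^{(\alpha,\beta)}$ at parameter $-x$, and the top row that of the column model at parameter $x'$. -}

module Defs where

open import Data.Nat as ℕ using (ℕ; zero; suc; _∸_)
open import Data.Nat.Properties as ℕP using ()
open import Data.Rational using (ℚ; 0ℚ; 1ℚ; _+_; _*_; _-_; -_; _÷_; ≢-nonZero)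
open import Data.Vec using (Vec; []; _∷_; zip; toList)
open import Data.Vec.Properties using (≡-dec)
open import Data.List using (List; []; _∷_; reverse)
open import Data.Product using (_×_; _,_)
open import Relation.Binary.PropositionalEquality using (_≡_; _≢_)
open import Relation.Nullary using (yes; no)
open import Relation.Binary.Definitions using (tri<; tri≈; tri>)

div : (p q : ℚ) → q ≢ 0ℚ → ℚ
div p q h = _÷_ p q {{≢-nonZero h}}

pow : ℚ → ℕ → ℚ
pow y zero    = 1ℚ
pow y (suc n) = y * pow y n

x′ : (α β x : ℚ) → 1ℚ + (α - β) * x ≢ 0ℚ → ℚ
x′ α β x h = div x (1ℚ + (α - β) * x) h

-- Weight is 0 unless a + b = c + d; horizontal labels lie in {0,1}
-- (a ≥ 2 never occurs in the enumeration below; we set its weight to 0).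
Wbot : (α β x : ℚ) → 1ℚ + α * x ≢ 0ℚ → ℕ → ℕ → ℕ → ℕ → ℚ
Wbot α β x h a b c d with a ℕ.+ b ℕ.≟ c ℕ.+ d
... | no _ = 0ℚ
... | yes _ with a | b | c | d
...   | zero | zero | zero | zero = 1ℚ
...   | zero | _    | _    | _    = div (1ℚ - β * x) (1ℚ + α * x) h
...   | suc zero | _ | _   | _    = div (- x) (1ℚ + α * x) h
...   | suc (suc _) | _ | _ | _   = 0ℚ

Wtop : (x' α β : ℚ) → 1ℚ - α * x' ≢ 0ℚ → ℕ → ℕ → ℕ → ℕ → ℚ
Wtop x' α β h a b c d with a ℕ.+ b ℕ.≟ c ℕ.+ d
... | no _ = 0ℚ
... | yes _ with ℕ.<-cmp b c
...   | tri≈ _ _ _ = pow y a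
  where y = div x' (1ℚ - α * x') h
...   | tri> _ _ _ = pow y a * div (1ℚ + β * x') (1ℚ - α * x') h
  where y = div x' (1ℚ - α * x') h
...   | tri< _ _ _ = 0ℚ

-- Sum over labelings of a two-row lattice, sites processed from right
-- to left.  The list holds the pairs (v_j , u_j) (bottom label, top label)
-- with the RIGHTMOST site first.  Arguments c, c' are the right labels of
-- the bottom and top rows at the current (rightmost remaining) site.
-- At a site: bottom left label a ∈ {0,1} is summed; the middle label d
-- is the unique value with a + v_j = c + d (any other value has bottom
-- weight 0); the top left label a' is the unique value with
-- a' + d = c' + u_j (any other value has top weight 0).  When ∸ truncates,
-- the conservation check inside the weights gives 0.  The empty list
-- corresponds to the free left boundary (each value counted once).
Zrev : (wb : ℕ → ℕ → ℕ → ℕ → ℚ) (wt : ℕ → ℕ → ℕ → ℕ → ℚ) →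
       List (ℕ × ℕ) → ℕ → ℕ → ℚ
Zrev wb wt [] c c' = 1ℚ
Zrev wb wt ((vj , uj) ∷ rest) c c' = term 0 + term 1
  where
  term : ℕ → ℚ
  term a = let d  = a ℕ.+ vj ∸ c
               a' = c' ℕ.+ uj ∸ d
           in wb a vj c d * wt a' d c' uj * Zrev wb wt rest a a'

Z : (α β x : ℚ) (h₁ : 1ℚ + α * x ≢ 0ℚ) (h₂ : 1ℚ + (α - β) * x ≢ 0ℚ)
    (h₃ : 1ℚ - α * x′ α β x h₂ ≢ 0ℚ) {L : ℕ} → Vec ℕ L → Vec ℕ L → ℚ
Z α β x h₁ h₂ h₃ v u =
  Zrev (Wbot α β x h₁) (Wtop (x′ α β x h₂) α β h₃)
       (reverse (toList (zip v u))) 0 0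

δ : {L : ℕ} → Vec ℕ L → Vec ℕ L → ℚ
δ u v with ≡-dec ℕ._≟_ u v
... | yes _ = 1ℚ
... | no _  = 0ℚ

-- Read the lattice from the right.  At a site with bottom label v and top label u,
-- entered with right labels (0, 0), conservation kills both choices of the bottom left
-- label when u < v; when u = v only the bottom left label 0 survives, with weight 1
-- (w₀ t = 1 if v > 0); and when u = v + k + 1 the two choices give y^(k+1) G and w₁ y^k t G', where
-- G' = G because a unit carried by the bottom row can be traded for one in the top row,
-- so they cancel by y + w₁ t = 0.  Both local identities are where x' = x / (1 + (α - β) x)
-- enters.

module Submission where

open import Defs
open import Data.Nat as ℕ using (ℕ; zero; suc; _∸_; _<_; z≤n; s≤s; less; equal; greater)
import Data.Nat.Properties as ℕ
open import Data.Rational using (ℚ; 0ℚ; 1ℚ; _+_; _*_; _-_; -_; 1/_; ≢-nonZero)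
open import Data.Rational.Properties using (*-inverseʳ; *-inverseˡ; *-zeroˡ; *-zeroʳ; +-identityʳ; *-identityˡ; *-identityʳ)
open import Data.Rational.Solver using (module +-*-Solver)
open import Data.List using (List; []; _∷_; reverse)
open import Data.List.Relation.Unary.Any using (Any; here; there)
import Data.List.Relation.Unary.Any.Properties as Any
open import Data.Vec using (Vec; []; _∷_; zip; toList)
open import Data.Vec.Properties using (≡-dec)
open import Data.Product using (_×_; _,_; uncurry)
open import Function using (_∘_)
open import Relation.Nullary using (yes; no; ¬_; contradiction)
open import Relation.Binary.Definitions using (tri<; tri≈; tri>)
open import Relation.Binary.PropositionalEquality

open +-*-Solver

x≡0⇒x*y*z≡0 : ∀ x y z → x ≡ 0ℚ → x * y * z ≡ 0ℚ
x≡0⇒x*y*z≡0 _ y z refl = trans (cong (_* z) (*-zeroˡ y)) (*-zeroˡ z)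

y≡0⇒x*y*z≡0 : ∀ x y z → y ≡ 0ℚ → x * y * z ≡ 0ℚ
y≡0⇒x*y*z≡0 x _ z refl = trans (cong (_* z) (*-zeroʳ x)) (*-zeroˡ z)

suc[m+n]∸m≡suc[n] : ∀ m n → suc (m ℕ.+ n) ∸ m ≡ suc n
suc[m+n]∸m≡suc[n] m n = trans (cong (_∸ m) (sym (ℕ.+-suc m n))) (ℕ.m+n∸m≡n m (suc n))

zip-offdiagonal : ∀ {L} {v u : Vec ℕ L} → v ≢ u → Any (uncurry _≢_) (toList (zip v u))
zip-offdiagonal {v = []}    {[]}    v≢u = contradiction refl v≢u
zip-offdiagonal {v = a ∷ v} {b ∷ u} v≢u with a ℕ.≟ b
... | no a≢b   = here a≢b
... | yes refl = there (zip-offdiagonal (v≢u ∘ cong (a ∷_)))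

zip-diagonal : ∀ {L} (v : Vec ℕ L) → ¬ Any (uncurry _≢_) (toList (zip v v))
zip-diagonal (a ∷ v) (here a≢a) = a≢a refl
zip-diagonal (a ∷ v) (there p)  = zip-diagonal v p

module TwoRow (α β x : ℚ) (h : 1ℚ + α * x ≢ 0ℚ) (x' : ℚ) (h' : 1ℚ - α * x' ≢ 0ℚ) where

  wb wt : ℕ → ℕ → ℕ → ℕ → ℚ
  wb = Wbot α β x h
  wt = Wtop x' α β h'

  G : List (ℕ × ℕ) → ℕ → ℕ → ℚ
  G = Zrev wb wt

  w₀ w₁ y t : ℚ
  w₀ = div (1ℚ - β * x) (1ℚ + α * x) h
  w₁ = div (- x) (1ℚ + α * x) h
  y  = div x' (1ℚ - α * x') h'
  t  = div (1ℚ + β * x') (1ℚ - α * x') h'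

  wb-shift : ∀ a v d → wb a v 1 d ≡ wb a v 0 (suc d)
  wb-shift a v d with a ℕ.+ v ℕ.≟ suc d
  ... | no _ = refl
  wb-shift zero          zero    d | yes _ = refl
  wb-shift zero          (suc v) d | yes _ = refl
  wb-shift (suc zero)    v       d | yes _ = refl
  wb-shift (suc (suc a)) v       d | yes _ = refl

  wb-vacant : ∀ v → wb 0 (suc v) 0 (suc v) ≡ w₀
  wb-vacant v with suc v ℕ.≟ suc v
  ... | yes _ = refl
  ... | no v≢v = contradiction refl v≢v

  wb-occupied : ∀ v → wb 1 v 0 (suc v) ≡ w₁
  wb-occupied v with suc v ℕ.≟ suc v
  ... | yes _ = refl
  ... | no v≢v = contradiction refl v≢v

  wt-nonconserving : ∀ a b c d → a ℕ.+ b ≢ c ℕ.+ d → wt a b c d ≡ 0ℚ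
  wt-nonconserving a b c d ¬e with a ℕ.+ b ℕ.≟ c ℕ.+ d
  ... | no _ = refl
  ... | yes e = contradiction e ¬e

  wt-< : ∀ a b c d → b < c → wt a b c d ≡ 0ℚ
  wt-< a b c d b<c with a ℕ.+ b ℕ.≟ c ℕ.+ d
  ... | no _ = refl
  ... | yes _ with ℕ.<-cmp b c
  ...   | tri< _ _ _ = refl
  ...   | tri≈ b≮c _ _ = contradiction b<c b≮c
  ...   | tri> b≮c _ _ = contradiction b<c b≮c

  wt-≡ : ∀ a b c d → a ℕ.+ b ≡ c ℕ.+ d → b ≡ c → wt a b c d ≡ pow y a
  wt-≡ a b c d e b≡c with a ℕ.+ b ℕ.≟ c ℕ.+ d
  ... | no ¬e = contradiction e ¬e
  ... | yes _ with ℕ.<-cmp b c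
  ...   | tri≈ _ _ _ = refl
  ...   | tri< _ b≢c _ = contradiction b≡c b≢c
  ...   | tri> _ b≢c _ = contradiction b≡c b≢c

  wt-> : ∀ a b c d → a ℕ.+ b ≡ c ℕ.+ d → c < b → wt a b c d ≡ pow y a * t
  wt-> a b c d e c<b with a ℕ.+ b ℕ.≟ c ℕ.+ d
  ... | no ¬e = contradiction e ¬e
  ... | yes _ with ℕ.<-cmp b c
  ...   | tri> _ _ _ = refl
  ...   | tri< _ _ c≮b = contradiction c<b c≮b
  ...   | tri≈ _ _ c≮b = contradiction c<b c≮b

  wt-top-overflow : ∀ a b d → d < b → wt a b 0 d ≡ 0ℚ
  wt-top-overflow a b d d<b =
    wt-nonconserving a b 0 d (λ e → ℕ.<⇒≱ d<b (ℕ.≤-trans (ℕ.m≤n+m b a) (ℕ.≤-reflexive e)))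

  wt-suc : ∀ a b c d → wt a b c d ≡ wt a (suc b) (suc c) d
  wt-suc a b c d with a ℕ.+ b ℕ.≟ c ℕ.+ d
  ... | no ¬e = sym (wt-nonconserving a (suc b) (suc c) d
                                       (¬e ∘ ℕ.suc-injective ∘ trans (sym (ℕ.+-suc a b))))
  ... | yes e with ℕ.<-cmp b c
  ...   | tri< b<c _ _ = sym (wt-< a (suc b) (suc c) d (s≤s b<c))
  ...   | tri≈ _ b≡c _ = sym (wt-≡ a (suc b) (suc c) d (trans (ℕ.+-suc a b) (cong suc e)) (cong suc b≡c))
  ...   | tri> _ _ c<b = sym (wt-> a (suc b) (suc c) d (trans (ℕ.+-suc a b) (cong suc e)) (s≤s c<b))

  site-shift : ∀ a v e a' n u g →
    wb a v 1 e * wt a' e n u * g ≡ wb a v 0 (suc e) * wt a' (suc e) (suc n) u * g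
  site-shift a v e a' n u g = cong₂ (λ p q → p * q * g) (wb-shift a v e) (wt-suc a' e n u)

  -- Moving a unit from the bottom right label to the top one raises every middle
  -- label by one, which no weight notices.
  G-shift : ∀ l n → G l 1 n ≡ G l 0 (suc n)
  G-shift [] n = refl
  G-shift ((zero , u) ∷ r) n =
    cong₂ _+_ (trans (x≡0⇒x*y*z≡0 (wb 0 0 1 0) (wt (n ℕ.+ u) 0 n u) (G r 0 (n ℕ.+ u)) refl)
                     (sym (y≡0⇒x*y*z≡0 (wb 0 0 0 0) (wt (suc n ℕ.+ u) 0 (suc n) u) (G r 0 (suc n ℕ.+ u))
                                         (wt-< (suc n ℕ.+ u) 0 (suc n) u (s≤s z≤n)))))
              (site-shift 1 0 0 (n ℕ.+ u) n u (G r 1 (n ℕ.+ u)))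
  G-shift ((suc v , u) ∷ r) n =
    cong₂ _+_ (site-shift 0 (suc v) v (n ℕ.+ u ∸ v) n u (G r 0 (n ℕ.+ u ∸ v)))
              (site-shift 1 (suc v) (suc v) (n ℕ.+ u ∸ suc v) n u (G r 1 (n ℕ.+ u ∸ suc v)))

  G-cons-below : ∀ v u r → u < v → G ((v , u) ∷ r) 0 0 ≡ 0ℚ
  G-cons-below v u r u<v =
    cong₂ _+_
      (y≡0⇒x*y*z≡0 (wb 0 v 0 v) _ (G r 0 (u ∸ v))
                   (wt-top-overflow (u ∸ v) v u u<v))
      (y≡0⇒x*y*z≡0 (wb 1 v 0 (suc v)) _ (G r 1 (u ∸ suc v))
                   (wt-top-overflow (u ∸ suc v) (suc v) u (ℕ.m<n⇒m<1+n u<v)))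

  module Inversion (w₀*t≡1 : w₀ * t ≡ 1ℚ) (y+w₁*t≡0 : y + w₁ * t ≡ 0ℚ) where

    vacant-site : ∀ a v u → a ℕ.+ v ≡ u → wb 0 v 0 v * wt a v 0 u ≡ pow y a
    vacant-site a zero u e = trans (*-identityˡ _) (wt-≡ a 0 0 u e refl)
    vacant-site a (suc v) u e = begin
      wb 0 (suc v) 0 (suc v) * wt a (suc v) 0 u
        ≡⟨ cong₂ _*_ (wb-vacant v) (wt-> a (suc v) 0 u e (s≤s z≤n)) ⟩
      w₀ * (pow y a * t)
        ≡⟨ solve 3 (λ w p s → w :* (p :* s) := p :* (w :* s)) refl w₀ (pow y a) t ⟩
      pow y a * (w₀ * t)                        ≡⟨ cong (pow y a *_) w₀*t≡1 ⟩
      pow y a * 1ℚ                              ≡⟨ *-identityʳ _ ⟩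
      pow y a                                   ∎
      where open ≡-Reasoning

    G-cons-diagonal : ∀ v r → G ((v , v) ∷ r) 0 0 ≡ G r 0 0
    G-cons-diagonal v r rewrite ℕ.n∸n≡0 v = begin
      wb 0 v 0 v * wt 0 v 0 v * G r 0 0 + wb 1 v 0 (suc v) * wt (v ∸ suc v) (suc v) 0 v * G r 1 (v ∸ suc v)
        ≡⟨ cong₂ _+_ (cong (_* G r 0 0) (vacant-site 0 v v refl))
                     (y≡0⇒x*y*z≡0 (wb 1 v 0 (suc v)) _ (G r 1 (v ∸ suc v))
                                  (wt-top-overflow (v ∸ suc v) (suc v) v (ℕ.n<1+n v))) ⟩
      1ℚ * G r 0 0 + 0ℚ ≡⟨ +-identityʳ _ ⟩
      1ℚ * G r 0 0      ≡⟨ *-identityˡ _ ⟩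
      G r 0 0           ∎
      where open ≡-Reasoning

    G-cons-above : ∀ v k r → G ((v , suc (v ℕ.+ k)) ∷ r) 0 0 ≡ 0ℚ
    G-cons-above v k r rewrite suc[m+n]∸m≡suc[n] v k | ℕ.m+n∸m≡n v k | G-shift r k = begin
      wb 0 v 0 v * wt (suc k) v 0 u * g + wb 1 v 0 (suc v) * wt k (suc v) 0 u * g
        ≡⟨ cong₂ (λ p q → p * g + q * g)
                 (vacant-site (suc k) v u (cong suc (ℕ.+-comm k v)))
                 (cong₂ _*_ (wb-occupied v)
                            (wt-> k (suc v) 0 u (trans (ℕ.+-suc k v) (cong suc (ℕ.+-comm k v))) (s≤s z≤n))) ⟩
      y * pow y k * g + w₁ * (pow y k * t) * g
        ≡⟨ solve 5 (λ y p w s g → y :* p :* g :+ w :* (p :* s) :* g := p :* g :* (y :+ w :* s))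
                   refl y (pow y k) w₁ t g ⟩
      pow y k * g * (y + w₁ * t) ≡⟨ cong (pow y k * g *_) y+w₁*t≡0 ⟩
      pow y k * g * 0ℚ           ≡⟨ *-zeroʳ (pow y k * g) ⟩
      0ℚ                         ∎
      where
      open ≡-Reasoning
      u = suc (v ℕ.+ k)
      g = G r 0 (suc k)

    G-cons-offdiagonal : ∀ v u r → v ≢ u → G ((v , u) ∷ r) 0 0 ≡ 0ℚ
    G-cons-offdiagonal v u r v≢u with ℕ.compare v u
    ... | less v k    = G-cons-above v k r
    ... | equal v     = contradiction refl v≢u
    ... | greater u k = G-cons-below (suc (u ℕ.+ k)) u r (s≤s (ℕ.m≤m+n u k))

    G-offdiagonal : ∀ {l} → Any (uncurry _≢_) l → G l 0 0 ≡ 0ℚ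
    G-offdiagonal {(v , u) ∷ r} (here v≢u) = G-cons-offdiagonal v u r v≢u
    G-offdiagonal {(v , u) ∷ r} (there p) with v ℕ.≟ u
    ... | yes refl = trans (G-cons-diagonal v r) (G-offdiagonal p)
    ... | no v≢u   = G-cons-offdiagonal v u r v≢u

    G-diagonal : ∀ l → ¬ Any (uncurry _≢_) l → G l 0 0 ≡ 1ℚ
    G-diagonal [] _ = refl
    G-diagonal ((v , u) ∷ r) ¬p with v ℕ.≟ u
    ... | yes refl = trans (G-cons-diagonal v r) (G-diagonal r (¬p ∘ there))
    ... | no v≢u   = contradiction (here v≢u) ¬p

    G-reverse-zip : ∀ {L} (v u : Vec ℕ L) → G (reverse (toList (zip v u))) 0 0 ≡ δ u v
    G-reverse-zip v u with ≡-dec ℕ._≟_ u v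
    ... | yes refl = G-diagonal _ (zip-diagonal u ∘ Any.reverse⁻)
    ... | no u≢v   = G-offdiagonal (Any.reverse⁺ (zip-offdiagonal (u≢v ∘ sym)))

-- Both identities are expanded in the defects 1 - D i, 1 - j E and 1 - F k,
-- where i, j, k are the inverses of D = 1 + α x, E = 1 + (α - β) x and F = 1 - α x j.
w₀*t-expansion : ∀ α β x i j k →
  ((1ℚ - β * x) * i) * ((1ℚ + β * (x * j)) * k) ≡
  ((1ℚ + α * x) * i) * ((1ℚ - α * (x * j)) * k) - (α + β) * x * (1ℚ - j * (1ℚ + (α - β) * x)) * i * k
w₀*t-expansion = solve 6 (λ α β x i j k →
  ((con 1ℚ :- β :* x) :* i) :* ((con 1ℚ :+ β :* (x :* j)) :* k) :=
  ((con 1ℚ :+ α :* x) :* i) :* ((con 1ℚ :- α :* (x :* j)) :* k)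
    :- (α :+ β) :* x :* (con 1ℚ :- j :* (con 1ℚ :+ (α :- β) :* x)) :* i :* k) refl

y+w₁*t-expansion : ∀ α β x i j k →
  (x * j) * k + ((- x) * i) * ((1ℚ + β * (x * j)) * k) ≡
  (x * j) * k * (1ℚ - (1ℚ + α * x) * i) - k * i * x * (1ℚ - j * (1ℚ + (α - β) * x))
y+w₁*t-expansion = solve 6 (λ α β x i j k →
  (x :* j) :* k :+ ((:- x) :* i) :* ((con 1ℚ :+ β :* (x :* j)) :* k) :=
  (x :* j) :* k :* (con 1ℚ :- (con 1ℚ :+ α :* x) :* i)
    :- k :* i :* x :* (con 1ℚ :- j :* (con 1ℚ :+ (α :- β) :* x))) refl

module _ (α β x : ℚ) (h₁ : 1ℚ + α * x ≢ 0ℚ)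
         (h₂ : 1ℚ + (α - β) * x ≢ 0ℚ) (h₃ : 1ℚ - α * x′ α β x h₂ ≢ 0ℚ) where

  open TwoRow α β x h₁ (x′ α β x h₂) h₃ using (w₀; w₁; y; t)

  private
    D E F i j k : ℚ
    D = 1ℚ + α * x
    E = 1ℚ + (α - β) * x
    F = 1ℚ - α * x′ α β x h₂
    i = (1/ D) {{≢-nonZero h₁}}
    j = (1/ E) {{≢-nonZero h₂}}
    k = (1/ F) {{≢-nonZero h₃}}

    Di≡1 : D * i ≡ 1ℚ
    Di≡1 = *-inverseʳ D {{≢-nonZero h₁}}
    jE≡1 : j * E ≡ 1ℚ
    jE≡1 = *-inverseˡ E {{≢-nonZero h₂}}
    Fk≡1 : F * k ≡ 1ℚ
    Fk≡1 = *-inverseʳ F {{≢-nonZero h₃}}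

  w₀*t≡1 : w₀ * t ≡ 1ℚ
  w₀*t≡1 = begin
    w₀ * t
      ≡⟨ w₀*t-expansion α β x i j k ⟩
    (D * i) * (F * k) - (α + β) * x * (1ℚ - j * E) * i * k
      ≡⟨ cong₂ (λ p q → p * q - (α + β) * x * (1ℚ - j * E) * i * k) Di≡1 Fk≡1 ⟩
    1ℚ * 1ℚ - (α + β) * x * (1ℚ - j * E) * i * k
      ≡⟨ cong (λ r → 1ℚ * 1ℚ - (α + β) * x * (1ℚ - r) * i * k) jE≡1 ⟩
    1ℚ * 1ℚ - (α + β) * x * (1ℚ - 1ℚ) * i * k
      ≡⟨ solve 5 (λ α β x i k → con 1ℚ :* con 1ℚ :- (α :+ β) :* x :* (con 1ℚ :- con 1ℚ) :* i :* k
                                := con 1ℚ) refl α β x i k ⟩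
    1ℚ ∎
    where open ≡-Reasoning

  y+w₁*t≡0 : y + w₁ * t ≡ 0ℚ
  y+w₁*t≡0 = begin
    y + w₁ * t
      ≡⟨ y+w₁*t-expansion α β x i j k ⟩
    (x * j) * k * (1ℚ - D * i) - k * i * x * (1ℚ - j * E)
      ≡⟨ cong₂ (λ p q → (x * j) * k * (1ℚ - p) - k * i * x * (1ℚ - q)) Di≡1 jE≡1 ⟩
    (x * j) * k * (1ℚ - 1ℚ) - k * i * x * (1ℚ - 1ℚ)
      ≡⟨ solve 4 (λ x i j k → (x :* j) :* k :* (con 1ℚ :- con 1ℚ) :- k :* i :* x :* (con 1ℚ :- con 1ℚ)
                              := con 0ℚ) refl x i j k ⟩
    0ℚ ∎
    where open ≡-Reasoning

proposition5p1 : (α β x : ℚ) (h₁ : 1ℚ + α * x ≢ 0ℚ)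
    (h₂ : 1ℚ + (α - β) * x ≢ 0ℚ) (h₃ : 1ℚ - α * x′ α β x h₂ ≢ 0ℚ)
    (L : ℕ) (v u : Vec ℕ L) → Z α β x h₁ h₂ h₃ v u ≡ δ u v
proposition5p1 α β x h₁ h₂ h₃ L =
  TwoRow.Inversion.G-reverse-zip α β x h₁ (x′ α β x h₂) h₃
    (w₀*t≡1 α β x h₁ h₂ h₃) (y+w₁*t≡0 α β x h₁ h₂ h₃)
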